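{- Let $\beta=(\beta_L)$ with all $\beta_L\ge2$, $k\ge1$, $X=(x^0,\dots,x^{k-1})\in\mathbb{N}^k$, $n\in\mathbb{N}$ and $R\in\mathbb{N}$. Choose $j\in\{0,\dots,k-1\}$ such that $x^j_R\ge x^i_R$ for all $i$. If $n_R\le\sum_{i}x^i_R$, then there exists $u=(u^0,\dots,u^{k-1})\in\{0,1,\dots,\beta_R-1\}^k$ such that: (1) $u^0+u^1+\cdots+u^{k-1}\equiv n_R \pmod{\beta_R}$; (2) $0\le x^i_R-u^i\le x^j_R-u^j$ for every $i$; (3) $\sum_i (x^i_R-u^i)\le\beta_R-1$.
   Context: $B_L=\beta_0\cdots\beta_{L-1}$, and for $m\in\mathbb{N}$, $m_L\in\{0,\dots,\beta_L-1\}$ denotes the $L$-th digit of the mixed-radix expansion $m=\sum_L m_LB_L$. -}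

module Defs where

open import Data.Nat using (ℕ; zero; suc; _+_; _*_; _≤_; NonZero; >-nonZero)
open import Data.Nat.Properties using (m*n≢0; <-≤-trans)
open import Data.Nat.DivMod using (_/_; _%_)
open import Data.Fin using (Fin)
open import Data.Fin.Properties using ()
open import Data.Nat.Base using (z<s; s≤s)
import Data.Vec.Functional as VF
open import Data.Vec.Functional using (Vector)

IsBase : (ℕ → ℕ) → Set
IsBase β = ∀ L → 2 ≤ β L

baseNonZero : (β : ℕ → ℕ) → IsBase β → ∀ L → NonZero (β L)
baseNonZero β h L = >-nonZero (<-≤-trans z<s (h L))

B : (ℕ → ℕ) → ℕ → ℕ
B β zero = 1
B β (suc L) = B β L * β L

BNonZero : (β : ℕ → ℕ) → IsBase β → ∀ L → NonZero (B β L)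
BNonZero β h zero = _
BNonZero β h (suc L) = m*n≢0 (B β L) (β L) {{BNonZero β h L}} {{baseNonZero β h L}}

-- m_L : the L-th digit of the mixed-radix expansion m = Σ_L m_L B_L
digit : (β : ℕ → ℕ) → IsBase β → ℕ → ℕ → ℕ
digit β h m L = ((_/_ m (B β L) {{BNonZero β h L}}) % β L) {{baseNonZero β h L}}

ModEqBase : (β : ℕ → ℕ) → IsBase β → ℕ → ℕ → ℕ → Set
ModEqBase β h R a b = (a % β R) {{baseNonZero β h R}} ≡' (b % β R) {{baseNonZero β h R}}
  where open import Relation.Binary.PropositionalEquality renaming (_≡_ to _≡'_)

sumFin : ∀ {k} → (Fin k → ℕ) → ℕ
sumFin f = VF.foldr _+_ 0 f

module Submission where

-- Write a = (a_0,…,a_{k-1}) for the R-th digits of the x^i, b = β_R, and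
-- S = Σ a.  Put D = (S ∸ n_R) mod b.  It suffices to find r ≤ a pointwise
-- with Σ r = D and r_j maximal among the r_i: then u = a ∸ r satisfies
-- Σ u = S ∸ D ≡ n_R (mod b), x^i_R ∸ u^i = r_i ≤ r_j, Σ r = D ≤ b ∸ 1, and
-- u^i ≤ a_i < b.
--
-- Such an r is produced by filling capacities: `greedyFill c E` pours an
-- amount E into the slots of capacity c from left to right, and
-- `fillFirst j c E` first fills slot j as far as possible and then pours
-- the rest greedily into the other slots.

open import Defs
open import Data.Nat using (ℕ; _+_; _∸_; _≤_; _<_)
open import Data.Fin using (Fin)
open import Data.Product using (Σ; _×_)

open import Data.Nat using (zero; suc; _*_; _⊓_; NonZero)
open import Data.Nat.Properties using
  ( ≤-trans; ≤-<-trans; m≤m+n; m≤n+m; +-assoc; +-comm; +-identityʳ; +-cancelʳ-≡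
  ; ⊓-glb; ⊓-monoʳ-≤; ⊓-zeroʳ; m⊓n≤m; m⊓n≤n; m≤n⇒m⊓n≡m; n≤0⇒n≡0
  ; m∸n≤m; m∸n+n≡m; m+[n∸m]≡n; m∸[m∸n]≡n; <⇒≤pred
  ; +-commutativeSemigroup; +-0-commutativeMonoid; module ≤-Reasoning )
open import Data.Nat.DivMod using (_%_; _/_; m≡m%n+[m/n]*n; [m+kn]%n≡m%n; m%n<n; m%n≤m)
open import Data.Fin using (zero; suc; _≟_)
open import Data.Product using (_,_)
open import Data.Vec.Functional using (tail; updateAt)
open import Data.Vec.Functional.Properties using (updateAt-updates; updateAt-minimal)
open import Function using (const)
open import Relation.Nullary using (yes; no)
open import Relation.Binary.PropositionalEquality
open import Algebra.Properties.CommutativeSemigroup +-commutativeSemigroup using (x∙yz≈x∙zy; x∙yz≈y∙xz)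
open import Algebra.Properties.CommutativeMonoid.Sum +-0-commutativeMonoid using (sum-cong-≗; ∑-distrib-+)

-- Finite sums.  `sumFin` is definitionally the monoid sum of the library,
-- so its congruence and additivity lemmas apply directly.

entry≤sum : ∀ {k} (f : Fin k → ℕ) (i : Fin k) → f i ≤ sumFin f
entry≤sum f zero    = m≤m+n (f zero) _
entry≤sum f (suc i) = ≤-trans (entry≤sum (tail f) i) (m≤n+m _ (f zero))

sum-set : ∀ {k} (f : Fin k → ℕ) (j : Fin k) (v : ℕ) →
  sumFin (updateAt f j (const v)) + f j ≡ v + sumFin f
sum-set f zero v = trans (+-assoc v _ (f zero)) (x∙yz≈x∙zy v _ (f zero))
sum-set f (suc j) v = begin
    f zero + sumFin (updateAt (tail f) j (const v)) + f (suc j)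
  ≡⟨ +-assoc (f zero) _ (f (suc j)) ⟩
    f zero + (sumFin (updateAt (tail f) j (const v)) + f (suc j))
  ≡⟨ cong (f zero +_) (sum-set (tail f) j v) ⟩
    f zero + (v + sumFin (tail f))
  ≡⟨ x∙yz≈y∙xz (f zero) v _ ⟩
    v + (f zero + sumFin (tail f)) ∎
  where open ≡-Reasoning

-- Filling a slot of capacity a and then one of capacity b with an amount x
-- places x ⊓ (a + b) in total.
⊓-+-split : ∀ x a b → x ⊓ a + (x ∸ a) ⊓ b ≡ x ⊓ (a + b)
⊓-+-split zero    zero    b = refl
⊓-+-split zero    (suc a) b = refl
⊓-+-split (suc x) zero    b = refl
⊓-+-split (suc x) (suc a) b = cong suc (⊓-+-split x a b)

filling-entry≤ : ∀ {k} (r c : Fin k → ℕ) (E : ℕ) → (∀ i → r i ≤ c i) →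
  sumFin r ≤ E → ∀ i → r i ≤ E ⊓ c i
filling-entry≤ r c E r≤c Σr≤E i = ⊓-glb (≤-trans (entry≤sum r i) Σr≤E) (r≤c i)

greedyFill : ∀ {k} → (Fin k → ℕ) → ℕ → Fin k → ℕ
greedyFill c E zero    = E ⊓ c zero
greedyFill c E (suc i) = greedyFill (tail c) (E ∸ c zero) i

greedyFill-≤ : ∀ {k} (c : Fin k → ℕ) (E : ℕ) (i : Fin k) → greedyFill c E i ≤ c i
greedyFill-≤ c E zero    = m⊓n≤n E (c zero)
greedyFill-≤ c E (suc i) = greedyFill-≤ (tail c) (E ∸ c zero) i

greedyFill-sum : ∀ {k} (c : Fin k → ℕ) (E : ℕ) → sumFin (greedyFill c E) ≡ E ⊓ sumFin c
greedyFill-sum {zero}  c E = sym (⊓-zeroʳ E)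
greedyFill-sum {suc k} c E =
  trans (cong (E ⊓ c zero +_) (greedyFill-sum (tail c) (E ∸ c zero)))
        (⊓-+-split E (c zero) (sumFin (tail c)))

fillFirst : ∀ {k} → Fin k → (Fin k → ℕ) → ℕ → Fin k → ℕ
fillFirst j c E = updateAt (greedyFill (updateAt c j (const 0)) (E ∸ c j)) j (const (E ⊓ c j))

fillFirst-at : ∀ {k} (j : Fin k) (c : Fin k → ℕ) (E : ℕ) → fillFirst j c E j ≡ E ⊓ c j
fillFirst-at j c E = updateAt-updates j _

fillFirst-≤ : ∀ {k} (j : Fin k) (c : Fin k → ℕ) (E : ℕ) (i : Fin k) → fillFirst j c E i ≤ c i
fillFirst-≤ j c E i with i ≟ j
... | yes refl = subst (_≤ c i) (sym (fillFirst-at i c E)) (m⊓n≤n E (c i))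
... | no i≢j   = subst₂ _≤_ (sym (updateAt-minimal i j _ i≢j)) (updateAt-minimal i j c i≢j)
                        (greedyFill-≤ (updateAt c j (const 0)) (E ∸ c j) i)

fillFirst-sum : ∀ {k} (j : Fin k) (c : Fin k → ℕ) (E : ℕ) → sumFin (fillFirst j c E) ≡ E ⊓ sumFin c
fillFirst-sum j c E = begin
    sumFin (fillFirst j c E)
  ≡⟨ sym (+-identityʳ _) ⟩
    sumFin (fillFirst j c E) + 0
  ≡⟨ cong (sumFin (fillFirst j c E) +_) (sym gj≡0) ⟩
    sumFin (fillFirst j c E) + g j
  ≡⟨ sum-set g j (E ⊓ c j) ⟩
    E ⊓ c j + sumFin g
  ≡⟨ cong (E ⊓ c j +_) (greedyFill-sum c′ (E ∸ c j)) ⟩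
    E ⊓ c j + (E ∸ c j) ⊓ sumFin c′
  ≡⟨ ⊓-+-split E (c j) (sumFin c′) ⟩
    E ⊓ (c j + sumFin c′)
  ≡⟨ cong (E ⊓_) (trans (+-comm (c j) _) (sum-set c j 0)) ⟩
    E ⊓ sumFin c ∎
  where
  open ≡-Reasoning
  c′ = updateAt c j (const 0)
  g  = greedyFill c′ (E ∸ c j)
  gj≡0 : g j ≡ 0
  gj≡0 = n≤0⇒n≡0 (subst (g j ≤_) (updateAt-updates j c) (greedyFill-≤ c′ (E ∸ c j) j))

fillFirst-max : ∀ {k} (j : Fin k) (c : Fin k → ℕ) (E : ℕ) → (∀ i → c i ≤ c j) →
  ∀ i → fillFirst j c E i ≤ fillFirst j c E j
fillFirst-max j c E c≤cj i = begin
    fillFirst j c E i  ≤⟨ filling-entry≤ _ c E (fillFirst-≤ j c E) Σ≤E i ⟩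
    E ⊓ c i            ≤⟨ ⊓-monoʳ-≤ E (c≤cj i) ⟩
    E ⊓ c j            ≡⟨ sym (fillFirst-at j c E) ⟩
    fillFirst j c E j  ∎
  where
  open ≤-Reasoning
  Σ≤E = subst (_≤ E) (sym (fillFirst-sum j c E)) (m⊓n≤m E (sumFin c))

-- Adding y and adding its remainder mod b have the same effect mod b.
%-cancel-remainder : ∀ x N y b .{{_ : NonZero b}} → x + y % b ≡ N + y → x % b ≡ N % b
%-cancel-remainder x N y b eq = trans (cong (_% b) x≡N+qb) ([m+kn]%n≡m%n N (y / b) b)
  where
  x≡N+qb : x ≡ N + y / b * b
  x≡N+qb = +-cancelʳ-≡ (y % b) x _ (begin
      x + y % b                   ≡⟨ eq ⟩
      N + y                       ≡⟨ cong (N +_) (m≡m%n+[m/n]*n y b) ⟩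
      N + (y % b + y / b * b)     ≡⟨ cong (N +_) (+-comm (y % b) _) ⟩
      N + (y / b * b + y % b)     ≡⟨ sym (+-assoc N _ (y % b)) ⟩
      N + y / b * b + y % b       ∎)
    where open ≡-Reasoning

digitChoice : (b : ℕ) .{{_ : NonZero b}} (k : ℕ) (a : Fin k → ℕ) (N : ℕ) (j : Fin k) →
  (∀ i → a i < b) → (∀ i → a i ≤ a j) → N ≤ sumFin a →
  Σ (Fin k → ℕ) λ u →
    (∀ i → u i < b) ×
    (sumFin u % b ≡ N % b) ×
    (∀ i → (u i ≤ a i) × (a i ∸ u i ≤ a j ∸ u j)) ×
    (sumFin (λ i → a i ∸ u i) ≤ b ∸ 1)
digitChoice b k a N j a<b a≤aj N≤S =
  u , u<b , Σu≡N , (λ i → m∸n≤m (a i) (r i) , r-max i) , Σr≤b-1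
  where
  S = sumFin a
  D = (S ∸ N) % b
  r = fillFirst j a D
  u : Fin k → ℕ
  u i = a i ∸ r i

  Σr≡D : sumFin r ≡ D
  Σr≡D = trans (fillFirst-sum j a D)
               (m≤n⇒m⊓n≡m (≤-trans (m%n≤m (S ∸ N) b) (m∸n≤m S N)))
  a-u≡r : ∀ i → a i ∸ u i ≡ r i
  a-u≡r i = m∸[m∸n]≡n (fillFirst-≤ j a D i)

  u<b : ∀ i → u i < b
  u<b i = ≤-<-trans (m∸n≤m (a i) (r i)) (a<b i)
  Σu+D≡S : sumFin u + D ≡ N + (S ∸ N)
  Σu+D≡S = begin
      sumFin u + D                  ≡⟨ cong (sumFin u +_) (sym Σr≡D) ⟩
      sumFin u + sumFin r           ≡⟨ sym (∑-distrib-+ u r) ⟩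
      sumFin (λ i → u i + r i)      ≡⟨ sum-cong-≗ (λ i → m∸n+n≡m (fillFirst-≤ j a D i)) ⟩
      S                             ≡⟨ sym (m+[n∸m]≡n N≤S) ⟩
      N + (S ∸ N)                   ∎
    where open ≡-Reasoning
  Σu≡N : sumFin u % b ≡ N % b
  Σu≡N = %-cancel-remainder (sumFin u) N (S ∸ N) b Σu+D≡S
  r-max : ∀ i → a i ∸ u i ≤ a j ∸ u j
  r-max i = subst₂ _≤_ (sym (a-u≡r i)) (sym (a-u≡r j)) (fillFirst-max j a D a≤aj i)
  Σr≤b-1 : sumFin (λ i → a i ∸ u i) ≤ b ∸ 1
  Σr≤b-1 = subst (_≤ b ∸ 1) (sym (trans (sum-cong-≗ a-u≡r) Σr≡D)) (<⇒≤pred (m%n<n (S ∸ N) b))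

lemma2 : (β : ℕ → ℕ) (hβ : IsBase β) (k : ℕ) → 1 ≤ k →
    (X : Fin k → ℕ) (n R : ℕ) (j : Fin k) →
    (∀ i → digit β hβ (X i) R ≤ digit β hβ (X j) R) →
    digit β hβ n R ≤ sumFin (λ i → digit β hβ (X i) R) →
    Σ (Fin k → ℕ) λ u →
    (∀ i → u i < β R) ×
    ModEqBase β hβ R (sumFin u) (digit β hβ n R) ×
    (∀ i → (u i ≤ digit β hβ (X i) R) × (digit β hβ (X i) R ∸ u i ≤ digit β hβ (X j) R ∸ u j)) ×
    (sumFin (λ i → digit β hβ (X i) R ∸ u i) ≤ β R ∸ 1)
lemma2 β hβ k _ X n R j digit≤digitj n≤Σ =
  digitChoice (β R) {{baseNonZero β hβ R}} k (λ i → digit β hβ (X i) R) (digit β hβ n R) j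
    digit<base digit≤digitj n≤Σ
  where
  digit<base : ∀ i → digit β hβ (X i) R < β R
  digit<base i = m%n<n _ (β R) {{baseNonZero β hβ R}}
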